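{- For each $p = 2^n \geq 4$, each $k$ from $1$ to $p$, and all $i,j\in\{1,\dots,p\}$ distinct from $k$, $$M_p[i,j] = M_p^*[\sigma_{p,k}(i), \sigma_{p,k}(j)].$$ In particular, the edge-weighted digraphs with adjacency matrices $M_p$ and $M_p^*$ are hypomorphic under the mappings $\sigma_{p,k}$.
   Context: Throughout, $p = 2^n$ with $n \ge 2$. The $4\times 4$ matrices $M_4$ and $M_4^*$ are, row by row, $M_4$: $(0,1,2,3)$, $(-1,0,3,-2)$, $(-2,-3,0,1)$, $(-3,2,-1,0)$; $M_4^*$: $(0,-2,-3,-1)$, $(2,0,1,-3)$, $(3,-1,0,2)$, $(1,3,-2,0)$. For $p = 2^n \ge 8$, $M_p$ and $M_p^*$ are $p\times p$ matrices consisting of a $(p/4)\times(p/4)$ array of $4\times 4$ blocks; with $I$ the $4\times 4$ identity and $1\le a,b\le p/4$ block indices, block $(a,b)$ of $M_p$ is: $M_4$ if $b-a=0$; $-M_4+4I$ if $b-a\equiv 1 \pmod 4$; $-M_4-4I$ if $b-a\equiv -1\pmod 4$; $M_4+(x+4)I$ if $b-a = y\cdot 2^x$ with $x\ge 1$ and $y\equiv 1\pmod 4$; $M_4-(x+4)I$ if $b-a=y\cdot 2^x$ with $x\ge1$ and $y\equiv -1\pmod 4$. Block $(a,b)$ of $M_p^*$ is: $M_4^*$ if $b-a=0$; $-M_4^*-4I$ if $b-a\equiv 1\pmod 4$; $-M_4^*+4I$ if $b-a\equiv -1\pmod 4$; $M_4^*-(x+4)I$ if $b-a=y\cdot 2^x$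 with $x\ge1$, $y\equiv 1\pmod 4$; $M_4^*+(x+4)I$ if $b-a=y\cdot 2^x$ with $x\ge 1$, $y\equiv -1\pmod 4$. For each $k\in\{1,\dots,p\}$, $\sigma_{p,k}$ is a map from $\{1,\dots,p\}\setminus\{k\}$ to itself, defined inductively. For $p=4$: $\sigma_{4,1}: 2\mapsto 4, 3\mapsto 2, 4\mapsto 3$; $\sigma_{4,2}: 1\mapsto 3, 3\mapsto 4, 4\mapsto 1$; $\sigma_{4,3}: 1\mapsto 4, 2\mapsto 1, 4\mapsto 2$; $\sigma_{4,4}: 1\mapsto 2, 2\mapsto 3, 3\mapsto 1$. For $p\ge 8$ and $i\ne k$: if $k\le p/2$, then $\sigma_{p,k}(i)=\sigma_{p/2,k}(i)+p/2$ for $i\le p/2$; $\sigma_{p,k}(i)=\sigma_{p/2,k}(i-p/2)$ for $i>p/2$, $i\ne k+p/2$; and $\sigma_{p,k}(k+p/2)=k+p/2$. If $k>p/2$, then $\sigma_{p,k}(i)=\sigma_{p/2,k-p/2}(i)+p/2$ for $i\le p/2$, $i\ne k-p/2$; $\sigma_{p,k}(i)=\sigma_{p/2,k-p/2}(i-p/2)$ for $i>p/2$; and $\sigma_{p,k}(k-p/2)=k-p/2$. Edge-weighted digraphs with adjacency matrices $A$, $B$ on points $1,\dots,p$ are hypomorphic if for each $k$ there is a bijection of the remaining points carrying the weights of $A$ with point $k$ deleted to those of $B$ with some point deleted, the deleted points of $B$ ranging over all points. -}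

module Defs where

open import Data.Nat as ℕ using (ℕ; zero; suc; _∸_; _^_; _≤ᵇ_; _≡ᵇ_)
open import Data.Integer as ℤ using (ℤ; +_; -_; ∣_∣; sign; _◃_)
open import Data.Integer.DivMod using (_%ℕ_)
open import Data.Bool using (Bool; true; false; if_then_else_)
open import Data.Product using (_×_; _,_; proj₁; proj₂)
open import Relation.Binary.PropositionalEquality using (_≡_; _≢_)

-- The 4×4 matrices M₄ and M₄*, indexed 0-based (rows/cols 0..3).

M4 : ℕ → ℕ → ℤ
M4 0 0 = + 0
M4 0 1 = + 1
M4 0 2 = + 2
M4 0 3 = + 3
M4 1 0 = - + 1
M4 1 1 = + 0
M4 1 2 = + 3
M4 1 3 = - + 2
M4 2 0 = - + 2
M4 2 1 = - + 3
M4 2 2 = + 0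
M4 2 3 = + 1
M4 3 0 = - + 3
M4 3 1 = + 2
M4 3 2 = - + 1
M4 3 3 = + 0
M4 _ _ = + 0

M4* : ℕ → ℕ → ℤ
M4* 0 0 = + 0
M4* 0 1 = - + 2
M4* 0 2 = - + 3
M4* 0 3 = - + 1
M4* 1 0 = + 2
M4* 1 1 = + 0
M4* 1 2 = + 1
M4* 1 3 = - + 3
M4* 2 0 = + 3
M4* 2 1 = - + 1
M4* 2 2 = + 0
M4* 2 3 = + 2
M4* 3 0 = + 1
M4* 3 1 = + 3
M4* 3 2 = - + 2
M4* 3 3 = + 0
M4* _ _ = + 0

δ : ℕ → ℕ → ℤ
δ r c = if r ≡ᵇ c then + 1 else + 0

-- 2-adic decomposition: for m > 0, split2 m m = (x , y) with m = y·2^x, y odd.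

split2 : (fuel m : ℕ) → ℕ × ℕ
split2 zero    m = 0 , m
split2 (suc f) zero = 0 , zero
split2 (suc f) (suc m) with suc m ℕ.% 2
... | zero  = let r = split2 f (suc m ℕ./ 2) in suc (proj₁ r) , proj₂ r
... | suc _ = 0 , suc m

twoVal : ℤ → ℕ
twoVal d = proj₁ (split2 ∣ d ∣ ∣ d ∣)

oddPart : ℤ → ℤ
oddPart d = sign d ◃ proj₂ (split2 ∣ d ∣ ∣ d ∣)

oddPart≡1mod4 : ℤ → Bool
oddPart≡1mod4 d = (oddPart d %ℕ 4) ≡ᵇ 1

-- Block (a,b) of M_p / M_p*, as a function of d = b - a, entry (r,c).

blockM : ℤ → ℕ → ℕ → ℤ
blockM (+ zero) r c = M4 r c
blockM d r c with twoVal d | oddPart≡1mod4 d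
... | zero  | true  = ℤ.- M4 r c ℤ.+ + 4 ℤ.* δ r c
... | zero  | false = ℤ.- M4 r c ℤ.- + 4 ℤ.* δ r c
... | suc x | true  = M4 r c ℤ.+ + (suc x ℕ.+ 4) ℤ.* δ r c
... | suc x | false = M4 r c ℤ.- + (suc x ℕ.+ 4) ℤ.* δ r c

blockM* : ℤ → ℕ → ℕ → ℤ
blockM* (+ zero) r c = M4* r c
blockM* d r c with twoVal d | oddPart≡1mod4 d
... | zero  | true  = ℤ.- M4* r c ℤ.- + 4 ℤ.* δ r c
... | zero  | false = ℤ.- M4* r c ℤ.+ + 4 ℤ.* δ r c
... | suc x | true  = M4* r c ℤ.- + (suc x ℕ.+ 4) ℤ.* δ r c
... | suc x | false = M4* r c ℤ.+ + (suc x ℕ.+ 4) ℤ.* δ r c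

-- M_p and M_p* for p = 2^n, with 1-based indices i j ∈ {1..p}.

Mp : (n i j : ℕ) → ℤ
Mp n i j = blockM ((+ ((j ∸ 1) ℕ./ 4)) ℤ.- (+ ((i ∸ 1) ℕ./ 4)))
                  ((i ∸ 1) ℕ.% 4) ((j ∸ 1) ℕ.% 4)

Mp* : (n i j : ℕ) → ℤ
Mp* n i j = blockM* ((+ ((j ∸ 1) ℕ./ 4)) ℤ.- (+ ((i ∸ 1) ℕ./ 4)))
                    ((i ∸ 1) ℕ.% 4) ((j ∸ 1) ℕ.% 4)

-- σ_{p,k} for p = 2^n (n ≥ 2), as σ n k i; values outside the
-- domain {1..p} \ {k} are junk.

σ4 : ℕ → ℕ → ℕ
σ4 1 2 = 4
σ4 1 3 = 2
σ4 1 4 = 3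
σ4 2 1 = 3
σ4 2 3 = 4
σ4 2 4 = 1
σ4 3 1 = 4
σ4 3 2 = 1
σ4 3 4 = 2
σ4 4 1 = 2
σ4 4 2 = 3
σ4 4 3 = 1
σ4 _ i = i

σ : (n k i : ℕ) → ℕ
σ zero k i = i
σ (suc zero) k i = i
σ (suc (suc zero)) k i = σ4 k i
σ (suc (suc (suc m))) k i =
  if k ≤ᵇ 2 ^ (suc (suc m))
  then (if i ≤ᵇ 2 ^ (suc (suc m)) then σ (suc (suc m)) k i ℕ.+ 2 ^ (suc (suc m))
        else if i ≡ᵇ k ℕ.+ 2 ^ (suc (suc m)) then k ℕ.+ 2 ^ (suc (suc m))
        else σ (suc (suc m)) k (i ∸ 2 ^ (suc (suc m))))
  else (if i ≤ᵇ 2 ^ (suc (suc m))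
        then (if i ≡ᵇ k ∸ 2 ^ (suc (suc m)) then k ∸ 2 ^ (suc (suc m))
              else σ (suc (suc m)) (k ∸ 2 ^ (suc (suc m))) i ℕ.+ 2 ^ (suc (suc m)))
        else σ (suc (suc m)) (k ∸ 2 ^ (suc (suc m))) (i ∸ 2 ^ (suc (suc m))))

Pt : (n k i : ℕ) → Set
Pt n k i = (1 ℕ.≤ i) × (i ℕ.≤ 2 ^ n) × (i ≢ k)

module Submission where

open import Defs
open import Data.Nat as ℕ using (ℕ; zero; suc; _∸_; _^_; _≤_; NonZero; s≤s; z≤n)
import Data.Nat.Properties as ℕP
open import Data.Nat.Properties using (allUpTo?; anyUpTo?)
open import Data.Nat.DivMod using (_%_; _/_)
import Data.Nat.DivMod as ℕD
open import Data.Nat.Divisibility using (divides)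
open import Data.Integer as ℤ
  using (ℤ; +_; -[1+_]; -_; _+_; _-_; _*_; -1ℤ; ∣_∣; sign; _◃_; _%ℕ_; _/ℕ_)
import Data.Integer.Properties as ℤP
import Data.Integer.DivMod as ℤD
open import Data.Integer.Tactic.RingSolver using (solve-∀)
import Data.Sign as Sign
open import Data.Bool using (Bool; true; false; not)
open import Data.Bool.Properties using (T-≡; not-¬; ¬-not; not-injective; not-involutive)
open import Data.Empty using (⊥-elim)
open import Data.Product using (_×_; _,_; proj₁; proj₂; ∃-syntax)
open import Data.Sum using (_⊎_; inj₁; inj₂)
open import Data.Unit using (tt)
open import Function.Base using (_∘_)
open import Function.Bundles using (Equivalence)
open import Relation.Binary using (tri<; tri≈; tri>)
open import Relation.Binary.PropositionalEquality
open import Relation.Nullary using (¬_; yes; no; Dec; ¬?; _×-dec_; _→-dec_; _⊎-dec_)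
open import Relation.Nullary.Decidable using (toWitness)
open import Algebra.Properties.AbelianGroup ℤP.+-0-abelianGroup using () renaming (∙-cancelʳ to +-cancelʳ)

-- A block of M_p (resp. M*_p) with block displacement d has off-diagonal part s(d) · M₄
-- (resp. s(d) · M₄*), where s(d) = ±1 according to the parity of d, and constant diagonal D(d)
-- (resp. −D(d)), where D(d) depends only on the 2-adic valuation of d and on its odd part modulo 4;
-- in particular D(−d) = −D(d).
--
-- The points of size 2p are i and i + p for the points i of size p, and σ_{2p,k} is σ_{p,k}
-- followed by a change of half, except that it fixes the partner k ± p of k.  A block displacement
-- of size 2p is twice one of size p plus 0 or ±1, so the claim for 2p follows from a stronger claim
-- for p, in which the displacements of M_p are shifted by z · p/4 and those of M*_p by −z · p/4 for
-- all integers z (EntriesMatch), together with a version for the row and the column of k in which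
-- the two shifts have odd sum (RowMatch), which takes care of the fixed partner.  For p = 4 both
-- claims reduce to finitely many identities between entries of M₄ and M₄*, checked by evaluation.

-- Residues

quotient-≮ : ∀ d .{{_ : NonZero d}} {r r′ q q′} → r ℕ.< d →
             + r + q * + d ≡ + r′ + q′ * + d → ¬ (q ℤ.< q′)
quotient-≮ d {r} {r′} {q} {q′} r<d eq q<q′ = ℤP.<-irrefl refl (begin-strict
  ℤ.suc q * + d     ≤⟨ ℤP.*-monoʳ-≤-nonNeg (+ d) (ℤP.i<j⇒suc[i]≤j q<q′) ⟩
  q′ * + d          ≤⟨ ℤP.i≤j+i _ (+ r′) ⟩
  + r′ + q′ * + d   ≡⟨ sym eq ⟩
  + r + q * + d     <⟨ ℤP.+-monoˡ-< (q * + d) (ℤ.+<+ r<d) ⟩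
  + d + q * + d     ≡⟨ sym (ℤP.suc-* q (+ d)) ⟩
  ℤ.suc q * + d     ∎)
  where open ℤP.≤-Reasoning

%ℕ-unique : ∀ d .{{_ : NonZero d}} x r q → r ℕ.< d → x ≡ + r + q * + d → x %ℕ d ≡ r
%ℕ-unique d x r q r<d x≡ with ℤP.<-cmp q (x /ℕ d)
... | tri< q<q′ _ _ = ⊥-elim (quotient-≮ d r<d (trans (sym x≡) division) q<q′)
  where division = ℤD.a≡a%ℕn+[a/ℕn]*n x d
... | tri> _ _ q>q′ = ⊥-elim (quotient-≮ d (ℤD.n%ℕd<d x d) (trans (sym division) x≡) q>q′)
  where division = ℤD.a≡a%ℕn+[a/ℕn]*n x d
... | tri≈ _ refl _ = ℤP.+-injective (+-cancelʳ (q * + d) _ _ (trans (sym (ℤD.a≡a%ℕn+[a/ℕn]*n x d)) x≡))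

residue-<2 : ∀ {r} → suc r ℕ.< 2 → r ≡ 0
residue-<2 lt = ℕP.n<1⇒n≡0 (ℕP.≤-pred lt)

%ℕ2≡∣∣%2 : ∀ x → x %ℕ 2 ≡ ∣ x ∣ % 2
%ℕ2≡∣∣%2 (+ n) = refl
%ℕ2≡∣∣%2 -[1+ n ] with suc n % 2 in eq
... | zero  = refl
... | suc r rewrite residue-<2 (subst (ℕ._< 2) eq (ℕD.m%n<n (suc n) 2)) = refl

neg-%ℕ2 : ∀ x → (- x) %ℕ 2 ≡ x %ℕ 2
neg-%ℕ2 x = trans (%ℕ2≡∣∣%2 (- x)) (trans (cong (_% 2) (ℤP.∣-i∣≡∣i∣ x)) (sym (%ℕ2≡∣∣%2 x)))

odd⇒%4 : ∀ u → u % 2 ≡ 1 → u % 4 ≡ 1 ⊎ u % 4 ≡ 3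
odd⇒%4 u u-odd with u % 4 | ℕD.m%n<n u 4 | ℕD.m∣n⇒o%n%m≡o%m 2 4 u (divides 2 refl)
... | 0 | _ | eq = ⊥-elim (ℕP.0≢1+n (trans eq u-odd))
... | 1 | _ | _  = inj₁ refl
... | 2 | _ | eq = ⊥-elim (ℕP.0≢1+n (trans eq u-odd))
... | 3 | _ | _  = inj₂ refl
... | suc (suc (suc (suc _))) | s≤s (s≤s (s≤s (s≤s ()))) | _

data Parity : ℤ → Set where
  even : ∀ q → Parity (+ 2 * q)
  odd  : ∀ q → Parity (+ 1 + + 2 * q)

parityOf : ∀ x → Parity x
parityOf x with x %ℕ 2 | ℤD.n%ℕd<d x 2 | ℤD.a≡a%ℕn+[a/ℕn]*n x 2
... | zero  | _  | x≡ = subst Parity (sym (trans x≡ (regroup (x /ℕ 2)))) (even (x /ℕ 2))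
  where
  regroup : ∀ q → + 0 + q * + 2 ≡ + 2 * q
  regroup = solve-∀
... | suc r | lt | x≡ rewrite residue-<2 lt = subst Parity (sym (trans x≡ (regroup (x /ℕ 2)))) (odd (x /ℕ 2))
  where
  regroup : ∀ q → + 1 + q * + 2 ≡ + 1 + + 2 * q
  regroup = solve-∀

even-%ℕ2 : ∀ q → (+ 2 * q) %ℕ 2 ≡ 0
even-%ℕ2 q = %ℕ-unique 2 _ 0 q (s≤s z≤n) (regroup q)
  where
  regroup : ∀ q → + 2 * q ≡ + 0 + q * + 2
  regroup = solve-∀

odd-%ℕ2 : ∀ q → (+ 1 + + 2 * q) %ℕ 2 ≡ 1
odd-%ℕ2 q = %ℕ-unique 2 _ 1 q (s≤s (s≤s z≤n)) (regroup q)
  where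
  regroup : ∀ q → + 1 + + 2 * q ≡ + 1 + q * + 2
  regroup = solve-∀

split2-odd : ∀ f n → 1 ≤ n → n ≤ f → proj₂ (split2 f n) % 2 ≡ 1
split2-odd (suc f) (suc n) _ n≤f with suc n % 2 in eq
... | suc r = trans eq (cong suc (residue-<2 (subst (ℕ._< 2) eq (ℕD.m%n<n (suc n) 2))))
... | zero  = split2-odd f (suc n / 2) 1≤half half≤f
  where
  1≤half : 1 ≤ suc n / 2
  1≤half with suc n / 2 in h
  ... | suc _ = s≤s z≤n
  ... | zero  = ⊥-elim (ℕP.0≢1+n (sym (trans (ℕD.m≡m%n+[m/n]*n (suc n) 2)
                                              (cong₂ (λ a b → a ℕ.+ b ℕ.* 2) eq h))))
  half≤f : suc n / 2 ≤ f
  half≤f = ℕP.≤-pred (ℕP.≤-trans (ℕD.m/n<m (suc n) 2 (s≤s (s≤s z≤n))) n≤f)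

split2-valuation-odd : ∀ f n → suc n % 2 ≡ 1 → proj₁ (split2 (suc f) (suc n)) ≡ 0
split2-valuation-odd f n n-odd with suc n % 2
... | zero  = ⊥-elim (ℕP.0≢1+n n-odd)
... | suc _ = refl

split2-valuation-even : ∀ f n → suc n % 2 ≡ 0 → ∃[ v ] proj₁ (split2 (suc f) (suc n)) ≡ suc v
split2-valuation-even f n n-even with suc n % 2
... | zero  = _ , refl
... | suc _ = ⊥-elim (ℕP.0≢1+n (sym n-even))

odd⇒positive : ∀ u → u % 2 ≡ 1 → 1 ≤ u
odd⇒positive (suc _) _ = s≤s z≤n

split2-double : ∀ f y → 1 ≤ y → split2 (suc f) (y ℕ.* 2) ≡ (suc (proj₁ (split2 f y)) , proj₂ (split2 f y))
split2-double f y@(suc _) _ with y ℕ.* 2 % 2 in 2y%2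
... | suc _ = ⊥-elim (ℕP.0≢1+n (trans (sym (ℕD.m*n%n≡0 y 2)) 2y%2))
... | zero  = cong (λ n → (suc (proj₁ (split2 f n)) , proj₂ (split2 f n))) (ℕD.m*n/n≡m y 2)

split2-2^m*odd : ∀ m u f → u % 2 ≡ 1 → 2 ^ m ℕ.* u ≤ f → split2 f (2 ^ m ℕ.* u) ≡ (m , u)
split2-2^m*odd zero u f u-odd u≤f rewrite ℕP.*-identityˡ u = go u f u-odd u≤f
  where
  go : ∀ u f → u % 2 ≡ 1 → u ≤ f → split2 f u ≡ (0 , u)
  go (suc u) (suc f) u-odd _ with suc u % 2
  ... | zero  = ⊥-elim (ℕP.0≢1+n u-odd)
  ... | suc _ = refl
split2-2^m*odd (suc m) u f u-odd le =
  subst (λ n → split2 f n ≡ (suc m , u)) (sym *-double) (go f (subst (_≤ f) *-double le))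
  where
  y = 2 ^ m ℕ.* u
  *-double : 2 ^ suc m ℕ.* u ≡ y ℕ.* 2
  *-double = trans (ℕP.*-assoc 2 (2 ^ m) u) (ℕP.*-comm 2 y)
  1≤y : 1 ≤ y
  1≤y = ℕP.*-mono-≤ (ℕP.m^n>0 2 m) (odd⇒positive u u-odd)
  y<2y : y ℕ.< y ℕ.* 2
  y<2y = ℕP.m<m*n y 2 {{ℕ.>-nonZero 1≤y}} (s≤s (s≤s z≤n))
  go : ∀ f → y ℕ.* 2 ≤ f → split2 f (y ℕ.* 2) ≡ (suc m , u)
  go zero le = ⊥-elim (ℕP.<⇒≱ y<2y (ℕP.≤-trans le z≤n))
  go (suc f) le = trans (split2-double f y 1≤y)
    (cong (λ p → (suc (proj₁ p) , proj₂ p)) (split2-2^m*odd m u f u-odd (ℕP.≤-pred (ℕP.≤-trans y<2y le))))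

sign-*-2^m : ∀ b m → sign (b * + 2 ^ m) ≡ sign b
sign-*-2^m b m with 2 ^ m | ℕP.m^n>0 2 m
... | suc k | _ = sign-*-suc b
  where
  sign-*-suc : ∀ b → sign (b * + suc k) ≡ sign b
  sign-*-suc (+ zero)  = refl
  sign-*-suc (+ suc _) = refl
  sign-*-suc -[1+ _ ]  = refl

twoAdic-odd*2^m : ∀ b m → b %ℕ 2 ≡ 1 → twoVal (b * + 2 ^ m) ≡ m × oddPart (b * + 2 ^ m) ≡ b
twoAdic-odd*2^m b m b-odd =
  cong proj₁ split , trans (cong₂ _◃_ (sign-*-2^m b m) (cong proj₂ split)) (ℤP.◃-inverse b)
  where
  split : split2 ∣ b * + 2 ^ m ∣ ∣ b * + 2 ^ m ∣ ≡ (m , ∣ b ∣)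
  split rewrite ℤP.abs-* b (+ 2 ^ m) | ℕP.*-comm ∣ b ∣ (2 ^ m) =
    split2-2^m*odd m ∣ b ∣ _ (trans (sym (%ℕ2≡∣∣%2 b)) b-odd) ℕP.≤-refl

odd*2^m≢0 : ∀ b m → b %ℕ 2 ≡ 1 → b * + 2 ^ m ≢ + 0
odd*2^m≢0 b m b-odd eq = ℕP.0≢1+n (trans (cong (_%ℕ 2) (sym (trans (sym oddPart≡b) (cong oddPart eq)))) b-odd)
  where oddPart≡b = proj₂ (twoAdic-odd*2^m b m b-odd)

-- Entries of a block

≤ᵇ-true : ∀ {a b} → a ≤ b → (a ℕ.≤ᵇ b) ≡ true
≤ᵇ-true a≤b = Equivalence.to T-≡ (ℕP.≤⇒≤ᵇ a≤b)

≤ᵇ-false : ∀ {a b} → b ℕ.< a → (a ℕ.≤ᵇ b) ≡ false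
≤ᵇ-false {a} {b} b<a with a ℕ.≤ᵇ b in eq
... | true  = ⊥-elim (ℕP.<⇒≱ b<a (ℕP.≤ᵇ⇒≤ a b (Equivalence.from T-≡ eq)))
... | false = refl

≡ᵇ-true : ∀ a → (a ℕ.≡ᵇ a) ≡ true
≡ᵇ-true a = Equivalence.to T-≡ (ℕP.≡⇒≡ᵇ a a refl)

≡ᵇ-false : ∀ {a b} → a ≢ b → (a ℕ.≡ᵇ b) ≡ false
≡ᵇ-false {a} {b} a≢b with a ℕ.≡ᵇ b in eq
... | true  = ⊥-elim (a≢b (ℕP.≡ᵇ⇒≡ a b (Equivalence.from T-≡ eq)))
... | false = refl

blockShape : (ℕ → ℕ → ℤ) → ℕ → Bool → ℕ → ℕ → ℤ
blockShape M zero    true  r c = - M r c + + 4 * δ r c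
blockShape M zero    false r c = - M r c - + 4 * δ r c
blockShape M (suc x) true  r c = M r c + + (suc x ℕ.+ 4) * δ r c
blockShape M (suc x) false r c = M r c - + (suc x ℕ.+ 4) * δ r c

blockM-shape : ∀ d → d ≢ + 0 → ∀ r c → blockM d r c ≡ blockShape M4 (twoVal d) (oddPart≡1mod4 d) r c
blockM-shape (+ zero) d≢0 = ⊥-elim (d≢0 refl)
blockM-shape (+ suc n) _ r c with twoVal (+ suc n) | oddPart≡1mod4 (+ suc n)
... | zero  | true  = refl
... | zero  | false = refl
... | suc _ | true  = refl
... | suc _ | false = refl
blockM-shape -[1+ n ] _ r c with twoVal -[1+ n ] | oddPart≡1mod4 -[1+ n ]
... | zero  | true  = refl
... | zero  | false = refl
... | suc _ | true  = refl
... | suc _ | false = refl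

blockM*-shape : ∀ d → d ≢ + 0 → ∀ r c → blockM* d r c ≡ blockShape M4* (twoVal d) (not (oddPart≡1mod4 d)) r c
blockM*-shape (+ zero) d≢0 = ⊥-elim (d≢0 refl)
blockM*-shape (+ suc n) _ r c with twoVal (+ suc n) | oddPart≡1mod4 (+ suc n)
... | zero  | true  = refl
... | zero  | false = refl
... | suc _ | true  = refl
... | suc _ | false = refl
blockM*-shape -[1+ n ] _ r c with twoVal -[1+ n ] | oddPart≡1mod4 -[1+ n ]
... | zero  | true  = refl
... | zero  | false = refl
... | suc _ | true  = refl
... | suc _ | false = refl

diagonalShape : ℕ → Bool → ℤ
diagonalShape zero    true  = + 4
diagonalShape zero    false = - + 4
diagonalShape (suc x) true  = + (suc x ℕ.+ 4)
diagonalShape (suc x) false = - + (suc x ℕ.+ 4)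

signShape : ℕ → ℤ
signShape zero    = -1ℤ
signShape (suc _) = + 1

diagonalShape-not : ∀ v b → diagonalShape v (not b) ≡ - diagonalShape v b
diagonalShape-not zero    true  = refl
diagonalShape-not zero    false = refl
diagonalShape-not (suc _) true  = refl
diagonalShape-not (suc _) false = refl

δ-diagonal : ∀ r → δ r r ≡ + 1
δ-diagonal r rewrite ≡ᵇ-true r = refl

δ-offDiagonal : ∀ {r c} → r ≢ c → δ r c ≡ + 0
δ-offDiagonal r≢c rewrite ≡ᵇ-false r≢c = refl

shape-diagonal : ∀ M v b r → M r r ≡ + 0 → blockShape M v b r r ≡ diagonalShape v b
shape-diagonal M zero    true  r Mrr≡0 rewrite Mrr≡0 | δ-diagonal r = refl
shape-diagonal M zero    false r Mrr≡0 rewrite Mrr≡0 | δ-diagonal r = refl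
shape-diagonal M (suc x) true  r Mrr≡0 rewrite Mrr≡0 | δ-diagonal r =
  trans (ℤP.+-identityˡ _) (ℤP.*-identityʳ _)
shape-diagonal M (suc x) false r Mrr≡0 rewrite Mrr≡0 | δ-diagonal r =
  trans (ℤP.+-identityˡ _) (cong -_ (ℤP.*-identityʳ _))

shape-offDiagonal : ∀ M v b {r c} → r ≢ c → blockShape M v b r c ≡ signShape v * M r c
shape-offDiagonal M zero    true  {r} {c} r≢c rewrite δ-offDiagonal r≢c =
  trans (ℤP.+-identityʳ _) (sym (ℤP.-1*i≡-i (M r c)))
shape-offDiagonal M zero    false {r} {c} r≢c rewrite δ-offDiagonal r≢c =
  trans (ℤP.+-identityʳ _) (sym (ℤP.-1*i≡-i (M r c)))
shape-offDiagonal M (suc x) true  {r} {c} r≢c rewrite δ-offDiagonal r≢c | ℤP.*-zeroʳ (+ (suc x ℕ.+ 4)) =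
  trans (ℤP.+-identityʳ _) (sym (ℤP.*-identityˡ _))
shape-offDiagonal M (suc x) false {r} {c} r≢c rewrite δ-offDiagonal r≢c | ℤP.*-zeroʳ (+ (suc x ℕ.+ 4)) =
  trans (ℤP.+-identityʳ _) (sym (ℤP.*-identityˡ _))

M4-diagonal : ∀ r → M4 r r ≡ + 0
M4-diagonal 0 = refl
M4-diagonal 1 = refl
M4-diagonal 2 = refl
M4-diagonal 3 = refl
M4-diagonal (suc (suc (suc (suc _)))) = refl

M4*-diagonal : ∀ r → M4* r r ≡ + 0
M4*-diagonal 0 = refl
M4*-diagonal 1 = refl
M4*-diagonal 2 = refl
M4*-diagonal 3 = refl
M4*-diagonal (suc (suc (suc (suc _)))) = refl

blockDiagonal : ℤ → ℤ
blockDiagonal (+ zero) = + 0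
blockDiagonal d        = diagonalShape (twoVal d) (oddPart≡1mod4 d)

blockSign : ℤ → ℤ
blockSign (+ zero) = + 1
blockSign d        = signShape (twoVal d)

blockDiagonal-nonzero : ∀ d → d ≢ + 0 → blockDiagonal d ≡ diagonalShape (twoVal d) (oddPart≡1mod4 d)
blockDiagonal-nonzero (+ zero)  d≢0 = ⊥-elim (d≢0 refl)
blockDiagonal-nonzero (+ suc _) _   = refl
blockDiagonal-nonzero -[1+ _ ]  _   = refl

blockSign-nonzero : ∀ d → d ≢ + 0 → blockSign d ≡ signShape (twoVal d)
blockSign-nonzero (+ zero)  d≢0 = ⊥-elim (d≢0 refl)
blockSign-nonzero (+ suc _) _   = refl
blockSign-nonzero -[1+ _ ]  _   = refl

module _ (d : ℤ) (d≢0 : d ≢ + 0) where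
  private
    v = twoVal d
    b = oddPart≡1mod4 d

  blockM-diagonal≢0 : ∀ r → blockM d r r ≡ blockDiagonal d
  blockM-diagonal≢0 r = begin
    blockM d r r            ≡⟨ blockM-shape d d≢0 r r ⟩
    blockShape M4 v b r r   ≡⟨ shape-diagonal M4 v b r (M4-diagonal r) ⟩
    diagonalShape v b       ≡⟨ blockDiagonal-nonzero d d≢0 ⟨
    blockDiagonal d         ∎
    where open ≡-Reasoning

  blockM*-diagonal≢0 : ∀ r → blockM* d r r ≡ - blockDiagonal d
  blockM*-diagonal≢0 r = begin
    blockM* d r r                 ≡⟨ blockM*-shape d d≢0 r r ⟩
    blockShape M4* v (not b) r r  ≡⟨ shape-diagonal M4* v (not b) r (M4*-diagonal r) ⟩
    diagonalShape v (not b)       ≡⟨ diagonalShape-not v b ⟩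
    - diagonalShape v b           ≡⟨ cong -_ (blockDiagonal-nonzero d d≢0) ⟨
    - blockDiagonal d             ∎
    where open ≡-Reasoning

  blockM-offDiagonal≢0 : ∀ {r c} → r ≢ c → blockM d r c ≡ blockSign d * M4 r c
  blockM-offDiagonal≢0 {r} {c} r≢c = begin
    blockM d r c            ≡⟨ blockM-shape d d≢0 r c ⟩
    blockShape M4 v b r c   ≡⟨ shape-offDiagonal M4 v b r≢c ⟩
    signShape v * M4 r c    ≡⟨ cong (_* M4 r c) (blockSign-nonzero d d≢0) ⟨
    blockSign d * M4 r c    ∎
    where open ≡-Reasoning

  blockM*-offDiagonal≢0 : ∀ {r c} → r ≢ c → blockM* d r c ≡ blockSign d * M4* r c
  blockM*-offDiagonal≢0 {r} {c} r≢c = begin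
    blockM* d r c                 ≡⟨ blockM*-shape d d≢0 r c ⟩
    blockShape M4* v (not b) r c  ≡⟨ shape-offDiagonal M4* v (not b) r≢c ⟩
    signShape v * M4* r c         ≡⟨ cong (_* M4* r c) (blockSign-nonzero d d≢0) ⟨
    blockSign d * M4* r c         ∎
    where open ≡-Reasoning

blockM-diagonal : ∀ d r → blockM d r r ≡ blockDiagonal d
blockM-diagonal (+ zero)     = M4-diagonal
blockM-diagonal d@(+ suc _)  = blockM-diagonal≢0 d (λ ())
blockM-diagonal d@(-[1+ _ ]) = blockM-diagonal≢0 d (λ ())

blockM*-diagonal : ∀ d r → blockM* d r r ≡ - blockDiagonal d
blockM*-diagonal (+ zero)     = M4*-diagonal
blockM*-diagonal d@(+ suc _)  = blockM*-diagonal≢0 d (λ ())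
blockM*-diagonal d@(-[1+ _ ]) = blockM*-diagonal≢0 d (λ ())

blockM-offDiagonal : ∀ d {r c} → r ≢ c → blockM d r c ≡ blockSign d * M4 r c
blockM-offDiagonal (+ zero)     _ = sym (ℤP.*-identityˡ _)
blockM-offDiagonal d@(+ suc _)    = blockM-offDiagonal≢0 d (λ ())
blockM-offDiagonal d@(-[1+ _ ])   = blockM-offDiagonal≢0 d (λ ())

blockM*-offDiagonal : ∀ d {r c} → r ≢ c → blockM* d r c ≡ blockSign d * M4* r c
blockM*-offDiagonal (+ zero)     _ = sym (ℤP.*-identityˡ _)
blockM*-offDiagonal d@(+ suc _)    = blockM*-offDiagonal≢0 d (λ ())
blockM*-offDiagonal d@(-[1+ _ ])   = blockM*-offDiagonal≢0 d (λ ())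

blockSign-even : ∀ d → d %ℕ 2 ≡ 0 → blockSign d ≡ + 1
blockSign-even (+ zero)     _ = refl
blockSign-even (+ suc n)    d-even = cong signShape (proj₂ (split2-valuation-even n n d-even))
blockSign-even d@(-[1+ n ]) d-even =
  cong signShape (proj₂ (split2-valuation-even n n (trans (sym (%ℕ2≡∣∣%2 d)) d-even)))

blockSign-odd : ∀ d → d %ℕ 2 ≡ 1 → blockSign d ≡ -1ℤ
blockSign-odd (+ suc n)    d-odd = cong signShape (split2-valuation-odd n n d-odd)
blockSign-odd d@(-[1+ n ]) d-odd = cong signShape (split2-valuation-odd n n (trans (sym (%ℕ2≡∣∣%2 d)) d-odd))

blockSign-neg : ∀ z → blockSign (- z) ≡ blockSign z
blockSign-neg z with parityOf z
... | even q = trans (blockSign-even (- (+ 2 * q)) (trans (neg-%ℕ2 (+ 2 * q)) (even-%ℕ2 q)))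
                     (sym (blockSign-even (+ 2 * q) (even-%ℕ2 q)))
... | odd q  = trans (blockSign-odd (- (+ 1 + + 2 * q)) (trans (neg-%ℕ2 (+ 1 + + 2 * q)) (odd-%ℕ2 q)))
                     (sym (blockSign-odd (+ 1 + + 2 * q) (odd-%ℕ2 q)))

blockSign-flip : ∀ z t → blockSign (+ 1 + + 2 * t - z) ≡ - blockSign z
blockSign-flip z t with parityOf z
... | even q = trans (blockSign-odd (+ 1 + + 2 * t - + 2 * q)
                       (subst (λ x → x %ℕ 2 ≡ 1) (sym (regroup t q)) (odd-%ℕ2 (t - q))))
                     (sym (cong -_ (blockSign-even (+ 2 * q) (even-%ℕ2 q))))
  where
  regroup : ∀ t q → + 1 + + 2 * t - + 2 * q ≡ + 1 + + 2 * (t - q)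
  regroup = solve-∀
... | odd q  = trans (blockSign-even (+ 1 + + 2 * t - (+ 1 + + 2 * q))
                       (subst (λ x → x %ℕ 2 ≡ 0) (sym (regroup t q)) (even-%ℕ2 (t - q))))
                     (sym (cong -_ (blockSign-odd (+ 1 + + 2 * q) (odd-%ℕ2 q))))
  where
  regroup : ∀ t q → + 1 + + 2 * t - (+ 1 + + 2 * q) ≡ + 2 * (t - q)
  regroup = solve-∀

blockDiagonal-odd*2^m : ∀ b m → b %ℕ 2 ≡ 1 →
                        blockDiagonal (b * + 2 ^ m) ≡ diagonalShape m (b %ℕ 4 ℕ.≡ᵇ 1)
blockDiagonal-odd*2^m b m b-odd =
  trans (blockDiagonal-nonzero _ (odd*2^m≢0 b m b-odd))
        (cong₂ diagonalShape (proj₁ twoAdic) (cong (λ y → y %ℕ 4 ℕ.≡ᵇ 1) (proj₂ twoAdic)))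
  where twoAdic = twoAdic-odd*2^m b m b-odd

blockDiagonal-mod4 : ∀ a s m → a %ℕ 2 ≡ 1 →
                     blockDiagonal ((a + + 4 * s) * + 2 ^ m) ≡ blockDiagonal (a * + 2 ^ m)
blockDiagonal-mod4 a s m a-odd = begin
  blockDiagonal ((a + + 4 * s) * + 2 ^ m)   ≡⟨ blockDiagonal-odd*2^m (a + + 4 * s) m b-odd ⟩
  diagonalShape m ((a + + 4 * s) %ℕ 4 ℕ.≡ᵇ 1) ≡⟨ cong (λ r → diagonalShape m (r ℕ.≡ᵇ 1)) b%4 ⟩
  diagonalShape m (a %ℕ 4 ℕ.≡ᵇ 1)            ≡⟨ blockDiagonal-odd*2^m a m a-odd ⟨
  blockDiagonal (a * + 2 ^ m)               ∎
  where
  open ≡-Reasoning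
  regroup₂ : ∀ q s → + 1 + q * + 2 + + 4 * s ≡ + 1 + (q + + 2 * s) * + 2
  regroup₂ = solve-∀
  b-odd : (a + + 4 * s) %ℕ 2 ≡ 1
  b-odd = %ℕ-unique 2 _ 1 (a /ℕ 2 + + 2 * s) (s≤s (s≤s z≤n))
    (trans (cong (_+ + 4 * s) (trans (ℤD.a≡a%ℕn+[a/ℕn]*n a 2) (cong (λ r → + r + (a /ℕ 2) * + 2) a-odd)))
           (regroup₂ (a /ℕ 2) s))
  regroup₄ : ∀ r q s → r + q * + 4 + + 4 * s ≡ r + (q + s) * + 4
  regroup₄ = solve-∀
  b%4 : (a + + 4 * s) %ℕ 4 ≡ a %ℕ 4
  b%4 = %ℕ-unique 4 _ (a %ℕ 4) (a /ℕ 4 + s) (ℤD.n%ℕd<d a 4)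
    (trans (cong (_+ + 4 * s) (ℤD.a≡a%ℕn+[a/ℕn]*n a 4)) (regroup₄ (+ (a %ℕ 4)) (a /ℕ 4) s))

ℕ-division-4 : ∀ u → + u ≡ + (u % 4) + + (u / 4) * + 4
ℕ-division-4 u = trans (cong +_ (ℕD.m≡m%n+[m/n]*n u 4))
                       (trans (ℤP.pos-+ (u % 4) _) (cong (_+_ (+ (u % 4))) (ℤP.pos-* (u / 4) 4)))

≡1mod4-neg : ∀ u → u % 2 ≡ 1 → ((Sign.- ◃ u) %ℕ 4 ℕ.≡ᵇ 1) ≡ not ((Sign.+ ◃ u) %ℕ 4 ℕ.≡ᵇ 1)
≡1mod4-neg u u-odd rewrite ℤP.+◃n≡+n u | ℤP.-◃n≡-n u with odd⇒%4 u u-odd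
... | inj₁ u%4≡1 rewrite u%4≡1 =
  cong (ℕ._≡ᵇ 1) (%ℕ-unique 4 (- + u) 3 (- + 1 - + (u / 4)) (s≤s (s≤s (s≤s (s≤s z≤n)))) neg-u)
  where
  regroup : ∀ q → - (+ 1 + q * + 4) ≡ + 3 + (- + 1 - q) * + 4
  regroup = solve-∀
  neg-u : - + u ≡ + 3 + (- + 1 - + (u / 4)) * + 4
  neg-u = trans (cong -_ (trans (ℕ-division-4 u) (cong (λ r → + r + + (u / 4) * + 4) u%4≡1))) (regroup (+ (u / 4)))
... | inj₂ u%4≡3 rewrite u%4≡3 =
  cong (ℕ._≡ᵇ 1) (%ℕ-unique 4 (- + u) 1 (- + 1 - + (u / 4)) (s≤s (s≤s z≤n)) neg-u)
  where
  regroup : ∀ q → - (+ 3 + q * + 4) ≡ + 1 + (- + 1 - q) * + 4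
  regroup = solve-∀
  neg-u : - + u ≡ + 1 + (- + 1 - + (u / 4)) * + 4
  neg-u = trans (cong -_ (trans (ℕ-division-4 u) (cong (λ r → + r + + (u / 4) * + 4) u%4≡3))) (regroup (+ (u / 4)))

oddPart≡1mod4-neg : ∀ n → oddPart≡1mod4 -[1+ n ] ≡ not (oddPart≡1mod4 (+ suc n))
oddPart≡1mod4-neg n =
  ≡1mod4-neg (proj₂ (split2 (suc n) (suc n))) (split2-odd (suc n) (suc n) (s≤s z≤n) ℕP.≤-refl)

blockDiagonal-neg : ∀ d → blockDiagonal (- d) ≡ - blockDiagonal d
blockDiagonal-neg (+ zero)  = refl
blockDiagonal-neg (+ suc n) =
  trans (cong (diagonalShape (twoVal (+ suc n))) (oddPart≡1mod4-neg n))
        (diagonalShape-not (twoVal (+ suc n)) (oddPart≡1mod4 (+ suc n)))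
blockDiagonal-neg -[1+ n ]  = sym (begin
  - diagonalShape v (oddPart≡1mod4 -[1+ n ])  ≡⟨ cong (λ b → - diagonalShape v b) (oddPart≡1mod4-neg n) ⟩
  - diagonalShape v (not b₊)                  ≡⟨ cong -_ (diagonalShape-not v b₊) ⟩
  - - diagonalShape v b₊                      ≡⟨ ℤP.neg-involutive _ ⟩
  diagonalShape v b₊                          ∎)
  where
  open ≡-Reasoning
  v = twoVal (+ suc n)
  b₊ = oddPart≡1mod4 (+ suc n)

-- Entries up to shifted block displacements

block : ℕ → ℤ
block i = + ((i ∸ 1) / 4)

position : ℕ → ℕ
position i = (i ∸ 1) % 4

-- For w = v = 0 this is Mp n i j ≡ Mp* n i* j*; otherwise the block displacement on the left is
-- shifted by w · 2 ^ m and the one on the right by v · 2 ^ m.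
Agree : ℕ → (i j i* j* : ℕ) → ℤ → ℤ → Set
Agree m i j i* j* w v = blockM (block j - block i + w * + 2 ^ m) (position i) (position j)
                      ≡ blockM* (block j* - block i* + v * + 2 ^ m) (position i*) (position j*)

agree-diagonal : ∀ m i i* w v → blockDiagonal (w * + 2 ^ m) ≡ - blockDiagonal (v * + 2 ^ m) →
                 Agree m i i i* i* w v
agree-diagonal m i i* w v diag = begin
  blockM d (position i) (position i)     ≡⟨ blockM-diagonal d (position i) ⟩
  blockDiagonal d                        ≡⟨ cong blockDiagonal (cancel (block i) _) ⟩
  blockDiagonal (w * + 2 ^ m)            ≡⟨ diag ⟩
  - blockDiagonal (v * + 2 ^ m)          ≡⟨ cong (-_ ∘ blockDiagonal) (cancel (block i*) _) ⟨
  - blockDiagonal d*                     ≡⟨ blockM*-diagonal d* (position i*) ⟨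
  blockM* d* (position i*) (position i*) ∎
  where
  open ≡-Reasoning
  d = block i - block i + w * + 2 ^ m
  d* = block i* - block i* + v * + 2 ^ m
  cancel : ∀ x y → x - x + y ≡ y
  cancel = solve-∀

agree-diagonal-neg : ∀ m i i* w → Agree m i i i* i* w (- w)
agree-diagonal-neg m i i* w = agree-diagonal m i i* w (- w) (begin
  blockDiagonal (w * + 2 ^ m)             ≡⟨ ℤP.neg-involutive _ ⟨
  - - blockDiagonal (w * + 2 ^ m)         ≡⟨ cong -_ (blockDiagonal-neg (w * + 2 ^ m)) ⟨
  - blockDiagonal (- (w * + 2 ^ m))       ≡⟨ cong (λ d → - blockDiagonal d) (ℤP.neg-distribˡ-* w _) ⟩
  - blockDiagonal (- w * + 2 ^ m)         ∎)
  where open ≡-Reasoning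

agree-diagonal-odd : ∀ m i i* q s {w v} → w ≡ + 1 + + 2 * q → - v ≡ w + + 4 * s → Agree m i i i* i* w v
agree-diagonal-odd m i i* q s {w} {v} refl -v≡ = agree-diagonal m i i* w v (begin
  blockDiagonal (w * + 2 ^ m)             ≡⟨ blockDiagonal-mod4 w s m (odd-%ℕ2 q) ⟨
  blockDiagonal ((w + + 4 * s) * + 2 ^ m) ≡⟨ cong (λ x → blockDiagonal (x * + 2 ^ m)) -v≡ ⟨
  blockDiagonal (- v * + 2 ^ m)           ≡⟨ cong blockDiagonal (ℤP.neg-distribˡ-* v _) ⟨
  blockDiagonal (- (v * + 2 ^ m))         ≡⟨ blockDiagonal-neg (v * + 2 ^ m) ⟩
  - blockDiagonal (v * + 2 ^ m)           ∎)
  where open ≡-Reasoning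

-- Doubling p

lift : ℕ → Bool → ℕ → ℕ
lift m false i = i
lift m true  i = i ℕ.+ 2 ^ suc (suc m)

bit : Bool → ℤ
bit false = + 0
bit true  = + 1

bit-not : ∀ e → bit (not e) ≡ + 1 - bit e
bit-not false = refl
bit-not true  = refl

quadruple : ∀ m → 2 ^ suc (suc m) ≡ 2 ^ m ℕ.* 4
quadruple m = trans (sym (ℕP.*-assoc 2 2 (2 ^ m))) (ℕP.*-comm 4 (2 ^ m))

block-lift : ∀ m e {i} → 1 ≤ i → block (lift m e i) ≡ block i + bit e * + 2 ^ m
block-lift m false {i} _ = sym (ℤP.+-identityʳ (block i))
block-lift m true {suc i} _ = begin
  + ((i ℕ.+ 2 ^ suc (suc m)) / 4)     ≡⟨ cong (λ x → + ((i ℕ.+ x) / 4)) (quadruple m) ⟩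
  + ((i ℕ.+ 2 ^ m ℕ.* 4) / 4)         ≡⟨ cong +_ (ℕD.+-distrib-/-∣ʳ i (divides (2 ^ m) refl)) ⟩
  + (i / 4 ℕ.+ 2 ^ m ℕ.* 4 / 4)       ≡⟨ cong (λ x → + (i / 4 ℕ.+ x)) (ℕD.m*n/n≡m (2 ^ m) 4) ⟩
  + (i / 4 ℕ.+ 2 ^ m)                 ≡⟨ ℤP.pos-+ (i / 4) (2 ^ m) ⟩
  + (i / 4) + + 2 ^ m                 ≡⟨ cong (_+_ (+ (i / 4))) (ℤP.*-identityˡ (+ 2 ^ m)) ⟨
  + (i / 4) + + 1 * + 2 ^ m           ∎
  where open ≡-Reasoning

position-lift : ∀ m e {i} → 1 ≤ i → position (lift m e i) ≡ position i
position-lift m false _ = refl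
position-lift m true {suc i} _ =
  trans (cong (λ x → (i ℕ.+ x) % 4) (quadruple m)) (ℕD.[m+kn]%n≡m%n i (2 ^ m) 4)

displacement-lift : ∀ m e f {i j} z → 1 ≤ i → 1 ≤ j →
  block (lift m f j) - block (lift m e i) + z * + 2 ^ suc m
    ≡ block j - block i + (bit f - bit e + + 2 * z) * + 2 ^ m
displacement-lift m e f {i} {j} z 1≤i 1≤j = begin
  block (lift m f j) - block (lift m e i) + z * + 2 ^ suc m
    ≡⟨ cong₂ (λ x y → x - y + z * + 2 ^ suc m) (block-lift m f 1≤j) (block-lift m e 1≤i) ⟩
  (block j + bit f * + 2 ^ m) - (block i + bit e * + 2 ^ m) + z * + 2 ^ suc m
    ≡⟨ cong (λ x → (block j + bit f * + 2 ^ m) - (block i + bit e * + 2 ^ m) + z * x) (ℤP.pos-* 2 (2 ^ m)) ⟩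
  (block j + bit f * + 2 ^ m) - (block i + bit e * + 2 ^ m) + z * (+ 2 * + 2 ^ m)
    ≡⟨ regroup (block j) (block i) (bit f) (bit e) z (+ 2 ^ m) ⟩
  block j - block i + (bit f - bit e + + 2 * z) * + 2 ^ m
    ∎
  where
  open ≡-Reasoning
  regroup : ∀ b a f e z h → (b + f * h) - (a + e * h) + z * (+ 2 * h) ≡ b - a + (f - e + + 2 * z) * h
  regroup = solve-∀

agree-lift : ∀ m e f e* f* {i j i* j*} z v → 1 ≤ i → 1 ≤ j → 1 ≤ i* → 1 ≤ j* →
             Agree m i j i* j* (bit f - bit e + + 2 * z) (bit f* - bit e* + + 2 * v) →
             Agree (suc m) (lift m e i) (lift m f j) (lift m e* i*) (lift m f* j*) z v
agree-lift m e f e* f* z v 1≤i 1≤j 1≤i* 1≤j* agree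
  rewrite displacement-lift m e f z 1≤i 1≤j | displacement-lift m e* f* v 1≤i* 1≤j*
        | position-lift m e 1≤i | position-lift m f 1≤j | position-lift m e* 1≤i* | position-lift m f* 1≤j* = agree

half<lift : ∀ m {i} → 1 ≤ i → 2 ^ suc (suc m) ℕ.< i ℕ.+ 2 ^ suc (suc m)
half<lift m 1≤i = ℕP.m<n+m _ 1≤i

σ-lift : ∀ m ek e {k i} → 1 ≤ k → k ≤ 2 ^ suc (suc m) → Pt (suc (suc m)) k i →
         σ (suc (suc (suc m))) (lift m ek k) (lift m e i) ≡ lift m (not e) (σ (suc (suc m)) k i)
σ-lift m false false 1≤k k≤h (1≤i , i≤h , i≢k) rewrite ≤ᵇ-true k≤h | ≤ᵇ-true i≤h = refl
σ-lift m false true {k} {i} 1≤k k≤h (1≤i , i≤h , i≢k)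
  rewrite ≤ᵇ-true k≤h | ≤ᵇ-false (half<lift m 1≤i)
        | ≡ᵇ-false {i ℕ.+ 2 ^ suc (suc m)} {k ℕ.+ 2 ^ suc (suc m)} (i≢k ∘ ℕP.+-cancelʳ-≡ _ i k)
        | ℕP.m+n∸n≡m i (2 ^ suc (suc m)) = refl
σ-lift m true false {k} 1≤k k≤h (1≤i , i≤h , i≢k)
  rewrite ≤ᵇ-false (half<lift m 1≤k) | ≤ᵇ-true i≤h
        | ℕP.m+n∸n≡m k (2 ^ suc (suc m)) | ≡ᵇ-false i≢k = refl
σ-lift m true true {k} {i} 1≤k k≤h (1≤i , i≤h , i≢k)
  rewrite ≤ᵇ-false (half<lift m 1≤k) | ≤ᵇ-false (half<lift m 1≤i)
        | ℕP.m+n∸n≡m k (2 ^ suc (suc m)) | ℕP.m+n∸n≡m i (2 ^ suc (suc m)) = refl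

σ-partner : ∀ m ek {k} → 1 ≤ k → k ≤ 2 ^ suc (suc m) →
            σ (suc (suc (suc m))) (lift m ek k) (lift m (not ek) k) ≡ lift m (not ek) k
σ-partner m false {k} 1≤k k≤h
  rewrite ≤ᵇ-true k≤h | ≤ᵇ-false (half<lift m 1≤k) | ≡ᵇ-true (k ℕ.+ 2 ^ suc (suc m)) = refl
σ-partner m true {k} 1≤k k≤h
  rewrite ≤ᵇ-false (half<lift m 1≤k) | ≤ᵇ-true k≤h
        | ℕP.m+n∸n≡m k (2 ^ suc (suc m)) | ≡ᵇ-true k = refl

lift-injective : ∀ m e f {a b} → 1 ≤ a → a ≤ 2 ^ suc (suc m) → 1 ≤ b → b ≤ 2 ^ suc (suc m) →
                 lift m e a ≡ lift m f b → a ≡ b × e ≡ f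
lift-injective m false false _ _ _ _ eq = eq , refl
lift-injective m true  true  _ _ _ _ eq = ℕP.+-cancelʳ-≡ _ _ _ eq , refl
lift-injective m true  false 1≤a _ _ b≤h eq = ⊥-elim (ℕP.<⇒≱ (half<lift m 1≤a) (subst (_≤ _) (sym eq) b≤h))
lift-injective m false true  _ a≤h 1≤b _ eq = ⊥-elim (ℕP.<⇒≱ (half<lift m 1≤b) (subst (_≤ _) eq a≤h))

lift-bounds : ∀ m e {i} → 1 ≤ i → i ≤ 2 ^ suc (suc m) →
              1 ≤ lift m e i × lift m e i ≤ 2 ^ suc (suc (suc m))
lift-bounds m false 1≤i i≤h = 1≤i , ℕP.≤-trans i≤h (ℕP.m≤m+n _ _)
lift-bounds m true  1≤i i≤h = ℕP.≤-trans 1≤i (ℕP.m≤m+n _ _) , ℕP.+-mono-≤ i≤h (ℕP.m≤m+n _ 0)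

data Lifted (m : ℕ) : ℕ → Set where
  lifted : ∀ e {i} → 1 ≤ i → i ≤ 2 ^ suc (suc m) → Lifted m (lift m e i)

liftedOf : ∀ m {i} → 1 ≤ i → i ≤ 2 ^ suc (suc (suc m)) → Lifted m i
liftedOf m {i} 1≤i i≤p with i ℕ.≤? 2 ^ suc (suc m)
... | yes i≤h = lifted false 1≤i i≤h
... | no  i≰h = subst (Lifted m) (ℕP.m∸n+n≡m {i} {h} (ℕP.<⇒≤ h<i))
                  (lifted true (ℕP.m<n⇒0<n∸m h<i) (ℕP.m≤n+o⇒m∸n≤o i h i≤h+h))
  where
  h = 2 ^ suc (suc m)
  h<i = ℕP.≰⇒> i≰h
  i≤h+h : i ≤ h ℕ.+ h
  i≤h+h = subst (i ≤_) (cong (h ℕ.+_) (ℕP.+-identityʳ h)) i≤p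

data PointOf (m k : ℕ) (ek : Bool) : ℕ → Set where
  partner : PointOf m k ek (lift m (not ek) k)
  lifted  : ∀ e {i} → Pt (suc (suc m)) k i → PointOf m k ek (lift m e i)

pointOf : ∀ m ek {k i} → Pt (suc (suc (suc m))) (lift m ek k) i → PointOf m k ek i
pointOf m ek {k} (1≤i , i≤p , i≢k) with liftedOf m 1≤i i≤p
... | lifted e {i} 1≤i i≤h with i ℕ.≟ k
...   | no  i≢k′ = lifted e (1≤i , i≤h , i≢k′)
...   | yes refl = subst (λ e → PointOf m k ek (lift m e k)) (sym (¬-not {e} {ek} λ { refl → i≢k refl })) partner

Pt-lift : ∀ m ek e {k i} → 1 ≤ k → k ≤ 2 ^ suc (suc m) →
          Pt (suc (suc m)) k i → Pt (suc (suc (suc m))) (lift m ek k) (lift m e i)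
Pt-lift m ek e 1≤k k≤h (1≤i , i≤h , i≢k) =
  let (1≤I , I≤p) = lift-bounds m e 1≤i i≤h
  in 1≤I , I≤p , λ eq → i≢k (proj₁ (lift-injective m e ek 1≤i i≤h 1≤k k≤h eq))

Pt-partner : ∀ m ek {k} → 1 ≤ k → k ≤ 2 ^ suc (suc m) →
             Pt (suc (suc (suc m))) (lift m ek k) (lift m (not ek) k)
Pt-partner m ek 1≤k k≤h =
  let (1≤K , K≤p) = lift-bounds m (not ek) 1≤k k≤h
  in 1≤K , K≤p , λ eq → not-¬ refl (sym (proj₂ (lift-injective m (not ek) ek 1≤k k≤h 1≤k k≤h eq)))

record IsPermutation (n k : ℕ) : Set where
  field
    closed     : ∀ i → Pt n k i → Pt n k (σ n k i)
    injective  : ∀ i j → Pt n k i → Pt n k j → σ n k i ≡ σ n k j → i ≡ j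
    surjective : ∀ j → Pt n k j → ∃[ i ] (Pt n k i × σ n k i ≡ j)

open IsPermutation

IsPermutation-lift : ∀ m ek {k} → 1 ≤ k → k ≤ 2 ^ suc (suc m) →
                     IsPermutation (suc (suc m)) k → IsPermutation (suc (suc (suc m))) (lift m ek k)
IsPermutation-lift m ek {k} 1≤k k≤h perm = record
  { closed = closed′ ; injective = injective′ ; surjective = surjective′ }
  where
  n = suc (suc (suc m))
  K = lift m ek k
  fixed = σ-partner m ek 1≤k k≤h

  closed′ : ∀ i → Pt n K i → Pt n K (σ n K i)
  closed′ i pt with pointOf m ek pt
  ... | partner     = subst (Pt n K) (sym fixed) (Pt-partner m ek 1≤k k≤h)
  ... | lifted e pt′ = subst (Pt n K) (sym (σ-lift m ek e 1≤k k≤h pt′))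
                            (Pt-lift m ek (not e) 1≤k k≤h (closed perm _ pt′))

  partner-not-image : ∀ f {j} → Pt (suc (suc m)) k j → lift m (not ek) k ≢ lift m (not f) (σ (suc (suc m)) k j)
  partner-not-image f pt eq with closed perm _ pt
  ... | 1≤σj , σj≤h , σj≢k = σj≢k (sym (proj₁ (lift-injective m (not ek) (not f) 1≤k k≤h 1≤σj σj≤h eq)))

  injective′ : ∀ i j → Pt n K i → Pt n K j → σ n K i ≡ σ n K j → i ≡ j
  injective′ i j pi pj eq with pointOf m ek pi | pointOf m ek pj
  ... | partner | partner = refl
  ... | partner | lifted f pj′ =
    ⊥-elim (partner-not-image f pj′ (trans (sym fixed) (trans eq (σ-lift m ek f 1≤k k≤h pj′))))
  ... | lifted e pi′ | partner =
    ⊥-elim (partner-not-image e pi′ (trans (sym fixed) (trans (sym eq) (σ-lift m ek e 1≤k k≤h pi′))))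
  ... | lifted e pi′ | lifted f pj′ with closed perm _ pi′ | closed perm _ pj′
  ...   | 1≤σi , σi≤h , _ | 1≤σj , σj≤h , _ =
    cong₂ (λ e i → lift m e i) (not-injective (proj₂ same)) (injective perm _ _ pi′ pj′ (proj₁ same))
    where
    same = lift-injective m (not e) (not f) 1≤σi σi≤h 1≤σj σj≤h
             (trans (sym (σ-lift m ek e 1≤k k≤h pi′)) (trans eq (σ-lift m ek f 1≤k k≤h pj′)))

  surjective′ : ∀ j → Pt n K j → ∃[ i ] (Pt n K i × σ n K i ≡ j)
  surjective′ j pt with pointOf m ek pt
  ... | partner = _ , Pt-partner m ek 1≤k k≤h , fixed
  ... | lifted f pj′ with surjective perm _ pj′
  ...   | i , pi′ , σi≡j = lift m (not f) i , Pt-lift m ek (not f) 1≤k k≤h pi′ ,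
          trans (σ-lift m ek (not f) 1≤k k≤h pi′) (cong₂ (λ e i → lift m e i) (not-involutive f) σi≡j)

-- The two shifts are odd with sum ≡ 0 (mod 4), so the two diagonal values are opposite.
partner-diagonal : ∀ m i i* e f → f ≡ not e → ∀ z t →
  Agree m i i i* i* (bit f - bit e + + 2 * z) (bit f - bit e + + 2 * (+ 1 + + 2 * t - z))
partner-diagonal m i i* false true refl z t =
  agree-diagonal-odd m i i* z (- + 1 - t) (odd-shift z) (opposite-shift z t)
  where
  odd-shift : ∀ z → + 1 - + 0 + + 2 * z ≡ + 1 + + 2 * z
  odd-shift = solve-∀
  opposite-shift : ∀ z t → - (+ 1 - + 0 + + 2 * (+ 1 + + 2 * t - z))
                           ≡ + 1 - + 0 + + 2 * z + + 4 * (- + 1 - t)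
  opposite-shift = solve-∀
partner-diagonal m i i* true false refl z t =
  agree-diagonal-odd m i i* (z - + 1) (- t) (odd-shift z) (opposite-shift z t)
  where
  odd-shift : ∀ z → + 0 - + 1 + + 2 * z ≡ + 1 + + 2 * (z - + 1)
  odd-shift = solve-∀
  opposite-shift : ∀ z t → - (+ 0 - + 1 + + 2 * (+ 1 + + 2 * t - z))
                           ≡ + 0 - + 1 + + 2 * z + + 4 * (- t)
  opposite-shift = solve-∀

EntriesMatch : ℕ → ℕ → Set
EntriesMatch m k = ∀ z i j → Pt (suc (suc m)) k i → Pt (suc (suc m)) k j →
  Agree m i j (σ (suc (suc m)) k i) (σ (suc (suc m)) k j) z (- z)

-- k stands in for its partner, which σ fixes one level up.
RowMatch : ℕ → ℕ → Set
RowMatch m k = ∀ z t j → Pt (suc (suc m)) k j →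
    Agree m k j k (σ (suc (suc m)) k j) z (+ 1 + + 2 * t - z)
  × Agree m j k (σ (suc (suc m)) k j) k z (+ 1 + + 2 * t - z)

RowMatch-lift : ∀ m ek {k} → 1 ≤ k → k ≤ 2 ^ suc (suc m) →
                IsPermutation (suc (suc m)) k → RowMatch m k → RowMatch (suc m) (lift m ek k)
RowMatch-lift m ek {k} 1≤k k≤h perm row z t J pt with pointOf m ek pt
... | partner rewrite σ-partner m ek 1≤k k≤h =
  agree-lift m ek (not ek) ek (not ek) z v 1≤k 1≤k 1≤k 1≤k
    (partner-diagonal m k k ek (not ek) refl z t) ,
  agree-lift m (not ek) ek (not ek) ek z v 1≤k 1≤k 1≤k 1≤k
    (partner-diagonal m k k (not ek) ek (sym (not-involutive ek)) z t)
  where v = + 1 + + 2 * t - z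
... | lifted f {j} pj rewrite σ-lift m ek f 1≤k k≤h pj =
  agree-lift m ek f ek (not f) z v 1≤k 1≤j 1≤k 1≤σj
    (subst (Agree m k j k σj (bit f - bit ek + + 2 * z))
      (trans (shift₁ (bit f) (bit ek) z t) (cong (λ x → x - bit ek + + 2 * v) (sym (bit-not f))))
      (proj₁ (row (bit f - bit ek + + 2 * z) (+ 1 - bit ek + + 2 * t) j pj))) ,
  agree-lift m f ek (not f) ek z v 1≤j 1≤k 1≤σj 1≤k
    (subst (Agree m j k σj k (bit ek - bit f + + 2 * z))
      (trans (shift₂ (bit f) (bit ek) z t) (cong (λ x → bit ek - x + + 2 * v) (sym (bit-not f))))
      (proj₂ (row (bit ek - bit f + + 2 * z) (bit ek + + 2 * t) j pj)))
  where
  v = + 1 + + 2 * t - z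
  σj = σ (suc (suc m)) k j
  1≤j = proj₁ pj
  1≤σj = proj₁ (closed perm j pj)
  shift₁ : ∀ f e z t → + 1 + + 2 * (+ 1 - e + + 2 * t) - (f - e + + 2 * z)
                       ≡ + 1 - f - e + + 2 * (+ 1 + + 2 * t - z)
  shift₁ = solve-∀
  shift₂ : ∀ f e z t → + 1 + + 2 * (e + + 2 * t) - (e - f + + 2 * z)
                       ≡ e - (+ 1 - f) + + 2 * (+ 1 + + 2 * t - z)
  shift₂ = solve-∀

EntriesMatch-lift : ∀ m ek {k} → 1 ≤ k → k ≤ 2 ^ suc (suc m) → IsPermutation (suc (suc m)) k →
                    RowMatch m k → EntriesMatch m k → EntriesMatch (suc m) (lift m ek k)
EntriesMatch-lift m ek {k} 1≤k k≤h perm row entries z I J pI pJ with pointOf m ek pI | pointOf m ek pJ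
... | partner | partner =
  subst₂ (λ a b → Agree (suc m) I J a b z (- z)) (sym fixed) (sym fixed) (agree-diagonal-neg (suc m) I I z)
  where fixed = σ-partner m ek 1≤k k≤h
... | partner | lifted f {j} pj =
  subst₂ (λ a b → Agree (suc m) I J a b z (- z)) (sym (σ-partner m ek 1≤k k≤h)) (sym (σ-lift m ek f 1≤k k≤h pj))
    (agree-lift m (not ek) f (not ek) (not f) z (- z) 1≤k (proj₁ pj) 1≤k (proj₁ (closed perm j pj))
      (subst (Agree m k j k (σ (suc (suc m)) k j) (bit f - b + + 2 * z))
        (trans (shift (bit f) b z) (cong (λ x → x - b + + 2 * (- z)) (sym (bit-not f))))
        (proj₁ (row (bit f - b + + 2 * z) (- b) j pj))))
  where
  b = bit (not ek)
  shift : ∀ f b z → + 1 + + 2 * (- b) - (f - b + + 2 * z) ≡ + 1 - f - b + + 2 * (- z)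
  shift = solve-∀
... | lifted e {i} pi | partner =
  subst₂ (λ a b → Agree (suc m) I J a b z (- z)) (sym (σ-lift m ek e 1≤k k≤h pi)) (sym (σ-partner m ek 1≤k k≤h))
    (agree-lift m e (not ek) (not e) (not ek) z (- z) (proj₁ pi) 1≤k (proj₁ (closed perm i pi)) 1≤k
      (subst (Agree m i k (σ (suc (suc m)) k i) k (b - bit e + + 2 * z))
        (trans (shift (bit e) b z) (cong (λ x → b - x + + 2 * (- z)) (sym (bit-not e))))
        (proj₂ (row (b - bit e + + 2 * z) (b - + 1) i pi))))
  where
  b = bit (not ek)
  shift : ∀ e b z → + 1 + + 2 * (b - + 1) - (b - e + + 2 * z) ≡ b - (+ 1 - e) + + 2 * (- z)
  shift = solve-∀
... | lifted e {i} pi | lifted f {j} pj =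
  subst₂ (λ a b → Agree (suc m) I J a b z (- z)) (sym (σ-lift m ek e 1≤k k≤h pi)) (sym (σ-lift m ek f 1≤k k≤h pj))
    (agree-lift m e f (not e) (not f) z (- z) (proj₁ pi) (proj₁ pj) (proj₁ (closed perm i pi))
                (proj₁ (closed perm j pj))
      (subst (Agree m i j (σ (suc (suc m)) k i) (σ (suc (suc m)) k j) w)
        (trans (shift (bit f) (bit e) z) (cong₂ (λ x y → x - y + + 2 * (- z)) (sym (bit-not f)) (sym (bit-not e))))
        (entries w i j pi pj)))
  where
  w = bit f - bit e + + 2 * z
  shift : ∀ f e z → - (f - e + + 2 * z) ≡ (+ 1 - f) - (+ 1 - e) + + 2 * (- z)
  shift = solve-∀

-- p = 4

Pt? : ∀ n k i → Dec (Pt n k i)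
Pt? n k i = 1 ℕ.≤? i ×-dec i ℕ.≤? 2 ^ n ×-dec ¬? (i ℕ.≟ k)

Pt₂⇒<5 : ∀ {k i} → Pt 2 k i → i ℕ.< 5
Pt₂⇒<5 (_ , i≤4 , _) = s≤s i≤4

σ₄-closed : ∀ {k} → k ℕ.< 5 → ∀ {i} → i ℕ.< 5 → Pt 2 k i → Pt 2 k (σ 2 k i)
σ₄-closed = toWitness {a? = allUpTo? (λ k → allUpTo? (λ i → Pt? 2 k i →-dec Pt? 2 k (σ 2 k i)) 5) 5} tt

σ₄-injective : ∀ {k} → k ℕ.< 5 → ∀ {i} → i ℕ.< 5 → ∀ {j} → j ℕ.< 5 →
               Pt 2 k i → Pt 2 k j → σ 2 k i ≡ σ 2 k j → i ≡ j
σ₄-injective = toWitness {a? = allUpTo? (λ k → allUpTo? (λ i → allUpTo? (λ j →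
  Pt? 2 k i →-dec Pt? 2 k j →-dec σ 2 k i ℕ.≟ σ 2 k j →-dec i ℕ.≟ j) 5) 5) 5} tt

σ₄-surjective : ∀ {k} → k ℕ.< 5 → ∀ {j} → j ℕ.< 5 → Pt 2 k j →
                ∃[ i ] (i ℕ.< 5 × Pt 2 k i × σ 2 k i ≡ j)
σ₄-surjective = toWitness {a? = allUpTo? (λ k → allUpTo? (λ j →
  Pt? 2 k j →-dec anyUpTo? (λ i → Pt? 2 k i ×-dec σ 2 k i ℕ.≟ j) 5) 5) 5} tt

σ₄-permutation : ∀ k → 1 ≤ k → k ≤ 4 → IsPermutation 2 k
σ₄-permutation k _ k≤4 = record
  { closed     = λ i pi → σ₄-closed (s≤s k≤4) (Pt₂⇒<5 pi) pi
  ; injective  = λ i j pi pj → σ₄-injective (s≤s k≤4) (Pt₂⇒<5 pi) (Pt₂⇒<5 pj) pi pj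
  ; surjective = λ j pj → let (i , _ , rest) = σ₄-surjective (s≤s k≤4) (Pt₂⇒<5 pj) pj in i , rest
  }

block-≤4 : ∀ {i} → i ≤ 4 → block i ≡ + 0
block-≤4 i≤4 = cong +_ (ℕD.m<n⇒m/n≡0 (s≤s (ℕP.∸-monoˡ-≤ 1 i≤4)))

displacement-≤4 : ∀ {i j} w → i ≤ 4 → j ≤ 4 → block j - block i + w * + 2 ^ 0 ≡ w
displacement-≤4 w i≤4 j≤4 =
  trans (cong₂ (λ a b → a - b + w * + 1) (block-≤4 j≤4) (block-≤4 i≤4)) (regroup w)
  where
  regroup : ∀ w → + 0 - + 0 + w * + 1 ≡ w
  regroup = solve-∀

agree-≤4 : ∀ {i j i* j*} w v → i ≤ 4 → j ≤ 4 → i* ≤ 4 → j* ≤ 4 →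
           position i ≢ position j → position i* ≢ position j* →
           blockSign w * M4 (position i) (position j) ≡ blockSign v * M4* (position i*) (position j*) →
           Agree 0 i j i* j* w v
agree-≤4 {i} {j} {i*} {j*} w v i≤4 j≤4 i*≤4 j*≤4 r≢c r*≢c* signed = begin
  blockM (block j - block i + w * + 2 ^ 0) (position i) (position j)
    ≡⟨ cong (λ d → blockM d (position i) (position j)) (displacement-≤4 w i≤4 j≤4) ⟩
  blockM w (position i) (position j)                     ≡⟨ blockM-offDiagonal w r≢c ⟩
  blockSign w * M4 (position i) (position j)             ≡⟨ signed ⟩
  blockSign v * M4* (position i*) (position j*)          ≡⟨ blockM*-offDiagonal v r*≢c* ⟨
  blockM* v (position i*) (position j*)
    ≡⟨ cong (λ d → blockM* d (position i*) (position j*)) (displacement-≤4 v i*≤4 j*≤4) ⟨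
  blockM* (block j* - block i* + v * + 2 ^ 0) (position i*) (position j*) ∎
  where open ≡-Reasoning

entries₄ : ∀ {k} → k ℕ.< 5 → 1 ≤ k → ∀ {i} → i ℕ.< 5 → ∀ {j} → j ℕ.< 5 → Pt 2 k i → Pt 2 k j →
  i ≡ j ⊎ (position i ≢ position j × position (σ 2 k i) ≢ position (σ 2 k j)
           × M4 (position i) (position j) ≡ M4* (position (σ 2 k i)) (position (σ 2 k j)))
entries₄ = toWitness {a? = allUpTo? (λ k → 1 ℕ.≤? k →-dec allUpTo? (λ i → allUpTo? (λ j →
  Pt? 2 k i →-dec Pt? 2 k j →-dec
    (i ℕ.≟ j ⊎-dec ¬? (position i ℕ.≟ position j) ×-dec ¬? (position (σ 2 k i) ℕ.≟ position (σ 2 k j))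
      ×-dec M4 (position i) (position j) ℤP.≟ M4* (position (σ 2 k i)) (position (σ 2 k j)))) 5) 5) 5} tt

rows₄ : ∀ {k} → k ℕ.< 5 → 1 ≤ k → ∀ {j} → j ℕ.< 5 → Pt 2 k j →
  position k ≢ position j × position k ≢ position (σ 2 k j)
  × M4 (position k) (position j) ≡ - M4* (position k) (position (σ 2 k j))
  × M4 (position j) (position k) ≡ - M4* (position (σ 2 k j)) (position k)
rows₄ = toWitness {a? = allUpTo? (λ k → 1 ℕ.≤? k →-dec allUpTo? (λ j →
  Pt? 2 k j →-dec
    ¬? (position k ℕ.≟ position j) ×-dec ¬? (position k ℕ.≟ position (σ 2 k j))
    ×-dec M4 (position k) (position j) ℤP.≟ - M4* (position k) (position (σ 2 k j))
    ×-dec M4 (position j) (position k) ℤP.≟ - M4* (position (σ 2 k j)) (position k)) 5) 5} tt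

EntriesMatch-base : ∀ k → 1 ≤ k → k ≤ 4 → EntriesMatch 0 k
EntriesMatch-base k 1≤k k≤4 z i j pi pj with entries₄ (s≤s k≤4) 1≤k (Pt₂⇒<5 pi) (Pt₂⇒<5 pj) pi pj
... | inj₁ refl = agree-diagonal-neg 0 i (σ 2 k i) z
... | inj₂ (r≢c , r*≢c* , M≡M*) =
  agree-≤4 z (- z) (proj₁ (proj₂ pi)) (proj₁ (proj₂ pj)) (proj₁ (proj₂ σpi)) (proj₁ (proj₂ σpj))
           r≢c r*≢c* (cong₂ _*_ (sym (blockSign-neg z)) M≡M*)
  where
  σpi = σ₄-closed (s≤s k≤4) (Pt₂⇒<5 pi) pi
  σpj = σ₄-closed (s≤s k≤4) (Pt₂⇒<5 pj) pj

RowMatch-base : ∀ k → 1 ≤ k → k ≤ 4 → RowMatch 0 k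
RowMatch-base k 1≤k k≤4 z t j pj with rows₄ (s≤s k≤4) 1≤k (Pt₂⇒<5 pj) pj
... | r≢c , r≢c* , row , column =
  agree-≤4 z v k≤4 j≤4 k≤4 σj≤4 r≢c r≢c* (flipped row) ,
  agree-≤4 z v j≤4 k≤4 σj≤4 k≤4 (r≢c ∘ sym) (r≢c* ∘ sym) (flipped column)
  where
  v = + 1 + + 2 * t - z
  j≤4 = proj₁ (proj₂ pj)
  σj≤4 = proj₁ (proj₂ (σ₄-closed (s≤s k≤4) (Pt₂⇒<5 pj) pj))
  flipped : ∀ {x y} → x ≡ - y → blockSign z * x ≡ blockSign v * y
  flipped {x} {y} refl = begin
    blockSign z * - y                   ≡⟨ ℤP.neg-distribʳ-* (blockSign z) y ⟨
    - (blockSign z * y)                 ≡⟨ ℤP.neg-distribˡ-* (blockSign z) y ⟩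
    - blockSign z * y                   ≡⟨ cong (_* y) (blockSign-flip z t) ⟨
    blockSign v * y                     ∎
    where open ≡-Reasoning

-- Induction on p

σ-invariants : ∀ m k → 1 ≤ k → k ≤ 2 ^ suc (suc m) →
               IsPermutation (suc (suc m)) k × RowMatch m k × EntriesMatch m k
σ-invariants zero k 1≤k k≤4 =
  σ₄-permutation k 1≤k k≤4 , RowMatch-base k 1≤k k≤4 , EntriesMatch-base k 1≤k k≤4
σ-invariants (suc m) k 1≤k k≤p with liftedOf m 1≤k k≤p
... | lifted ek {k} 1≤k k≤h with σ-invariants m k 1≤k k≤h
...   | perm , row , entries =
  IsPermutation-lift m ek 1≤k k≤h perm ,
  RowMatch-lift m ek 1≤k k≤h perm row ,
  EntriesMatch-lift m ek 1≤k k≤h perm row entries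

Agree⇒Mp : ∀ m n i j i* j* → Agree m i j i* j* (+ 0) (+ 0) → Mp n i j ≡ Mp* n i* j*
Agree⇒Mp m n i j i* j* agree =
  trans (cong (λ d → blockM d (position i) (position j)) (sym (ℤP.+-identityʳ (block j - block i))))
        (trans agree
               (cong (λ d → blockM* d (position i*) (position j*)) (ℤP.+-identityʳ (block j* - block i*))))

theorem1 : ∀ n → 2 ≤ n → ∀ k → 1 ≤ k → k ≤ 2 ^ n →
    (∀ i j → Pt n k i → Pt n k j → Mp n i j ≡ Mp* n (σ n k i) (σ n k j))
    × (∀ i → Pt n k i → Pt n k (σ n k i))
    × (∀ i j → Pt n k i → Pt n k j → σ n k i ≡ σ n k j → i ≡ j)
    × (∀ j → Pt n k j → ∃[ i ] (Pt n k i × σ n k i ≡ j))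
theorem1 (suc (suc m)) (s≤s (s≤s _)) k 1≤k k≤p with σ-invariants m k 1≤k k≤p
... | perm , _ , entries =
  (λ i j pi pj → Agree⇒Mp m n i j (σ n k i) (σ n k j) (entries (+ 0) i j pi pj)) ,
  closed perm , injective perm , surjective perm
  where n = suc (suc m)
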